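{- Let $G=(V,E)$ be a graph, let $S\subseteq V$ be such that $G\setminus S$ is a cluster graph, and let $\mathcal C$ be the set of cliques forming the connected components of $G\setminus S$. If $G$ admits a HIST, then $G$ admits a HIST $T$ with the following property: for each clique $C\in\mathcal C$ and each partition $(M_1,\ldots,M_l)$ of $C$ into sets of pairwise true twins, every $M_i$ satisfies $|\{u\in M_i : d_T(u)\ge 3\}|\le 1$.
   Context: All graphs are finite, simple and undirected. A HIST (homeomorphically irreducible spanning tree) of a connected graph $G$ is a spanning tree of $G$ with no vertex of degree exactly $2$ in the tree; $d_T(u)$ is the degree of $u$ in $T$. A cluster graph is a graph in which every connected component is a complete graph. Two vertices $u,v$ are true twins if they are adjacent and $N(u)\setminus\{v\}=N(v)\setminus\{u\}$, where $N(\cdot)$ denotes the neighbourhood in $G$. -}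

module Defs where

open import Data.Nat using (ℕ; zero; suc; _≤_; _+_)
open import Data.Bool using (Bool; true; false)
open import Data.Fin using (Fin)
open import Data.List using (List; []; _∷_; map; length; _++_; [_])
open import Data.List.Base using (allFin)
open import Data.List.Relation.Unary.Linked using (Linked)
open import Data.List.Relation.Unary.Unique.Propositional using (Unique)
open import Data.Product using (Σ; _×_; ∃; ∃-syntax)
open import Relation.Binary.PropositionalEquality using (_≡_; _≢_)
open import Relation.Binary.Construct.Closure.ReflexiveTransitive using (Star)

record Graph (n : ℕ) : Set where
  field
    adj   : Fin n → Fin n → Bool
    sym   : ∀ u v → adj u v ≡ adj v u
    irref : ∀ u → adj u u ≡ false
open Graph public

Edge : ∀ {n} → Graph n → Fin n → Fin n → Set
Edge G u v = adj G u v ≡ true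

Connected : ∀ {n} → Graph n → Set
Connected G = ∀ u v → Star (Edge G) u v

-- A cycle: a list of at least 3 distinct vertices, consecutive ones adjacent,
-- and the last adjacent to the first.
HasCycle : ∀ {n} → Graph n → Set
HasCycle {n} G = Σ (Fin n) λ x → Σ (List (Fin n)) λ xs →
  (2 ≤ length xs) × Unique (x ∷ xs) × Linked (Edge G) (x ∷ xs ++ [ x ])

Acyclic : ∀ {n} → Graph n → Set
Acyclic G = HasCycle G → Data.Empty.⊥
  where import Data.Empty

Subgraph : ∀ {n} → Graph n → Graph n → Set
Subgraph T G = ∀ u v → Edge T u v → Edge G u v

SpanningTree : ∀ {n} → Graph n → Graph n → Set
SpanningTree T G = Subgraph T G × Connected T × Acyclic T

countTrue : List Bool → ℕ
countTrue [] = 0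
countTrue (true ∷ bs) = suc (countTrue bs)
countTrue (false ∷ bs) = countTrue bs

deg : ∀ {n} → Graph n → Fin n → ℕ
deg {n} T u = countTrue (map (adj T u) (allFin n))

HIST : ∀ {n} → Graph n → Graph n → Set
HIST T G = SpanningTree T G × (∀ u → deg T u ≢ 2)

VSet : ℕ → Set
VSet n = Fin n → Bool

EdgeMinus : ∀ {n} → Graph n → VSet n → Fin n → Fin n → Set
EdgeMinus G S u v = S u ≡ false × S v ≡ false × Edge G u v

SameComp : ∀ {n} → Graph n → VSet n → Fin n → Fin n → Set
SameComp G S u v = S u ≡ false × S v ≡ false × Star (EdgeMinus G S) u v

-- G ∖ S is a cluster graph: every connected component is complete, i.e.
-- any two distinct vertices in the same component of G ∖ S are adjacent.
IsCluster : ∀ {n} → Graph n → VSet n → Set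
IsCluster G S = ∀ u v → u ≢ v → SameComp G S u v → Edge G u v

IsComponent : ∀ {n} → Graph n → VSet n → VSet n → Set
IsComponent {n} G S C =
  (∃[ x ] C x ≡ true) ×
  (∀ u → C u ≡ true → S u ≡ false) ×
  (∀ u v → C u ≡ true → (C v ≡ true → SameComp G S u v) × (SameComp G S u v → C v ≡ true))

TrueTwins : ∀ {n} → Graph n → Fin n → Fin n → Set
TrueTwins G u v = Edge G u v × (∀ w → w ≢ u → w ≢ v → adj G u w ≡ adj G v w)

-- A partition (M_1, …, M_l) of C into sets of pairwise true twins,
-- given by the block index p u of each u ∈ C (M_i = {u ∈ C | p u = i}),
-- every block non-empty.
TwinPartition : ∀ {n} → Graph n → VSet n → (l : ℕ) → (Fin n → Fin l) → Set
TwinPartition {n} G C l p =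
  (∀ i → ∃[ u ] (C u ≡ true × p u ≡ i)) ×
  (∀ u v → C u ≡ true → C v ≡ true → p u ≡ p v → u ≢ v → TrueTwins G u v)

open import Data.Bool using (_∧_)
open import Data.Nat using (_<ᵇ_)
open import Data.Fin using (_≟_)
open import Relation.Nullary.Decidable using (⌊_⌋)

highDegInBlock : ∀ {n} → Graph n → VSet n → {l : ℕ} → (Fin n → Fin l) → Fin l → ℕ
highDegInBlock {n} T C p i =
  countTrue (map (λ u → C u ∧ ⌊ p u ≟ i ⌋ ∧ (2 <ᵇ deg T u)) (allFin n))

-- Let u ≠ v be true twins of degree at least 3 in a HIST T, and let w₀ be the neighbour of v on the
-- tree path from v to u. Replacing every other tree edge vy by uy (an edge of G, as u and v are
-- twins) gives a spanning tree: the path v w₀ … u keeps it connected, and a cycle through u would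
-- close a cycle of T around an edge at u or at v. In the new tree v is a leaf, u has not lost degree
-- and every other vertex keeps its degree, so it is a HIST with fewer vertices of degree at least 3.
-- Iterating, no two true twins both have degree at least 3, which leaves at most one such vertex in
-- every twin class.
module Submission where

open import Defs renaming (sym to adj-sym)
open import Data.Bool using (Bool; true; false; _∧_; _∨_)
open import Data.Bool.Properties using (¬-not; ∨-identityʳ; ∨-zeroʳ; T-≡)
  renaming (_≟_ to _≟ᵇ_)
open import Data.Empty using (⊥-elim)
open import Data.Fin using (Fin; zero; suc; _≟_)
open import Data.Fin.Properties using (suc-injective; 0≢1+n; any?; all?)
open import Data.List using (List; []; _∷_; _++_; [_]; length; map; allFin)
open import Data.List.Properties using (map-tabulate; map-cong; ++-assoc)
open import Data.List.Membership.Propositional using (_∈_)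
open import Data.List.Membership.Propositional.Properties using (∈-∃++)
open import Data.List.Relation.Binary.Permutation.Propositional using (_↭_; ↭⇒↭ₛ)
open import Data.List.Relation.Binary.Permutation.Propositional.Properties using (++-comm; ↭-length)
import Data.List.Relation.Binary.Permutation.Setoid.Properties as Permutationₛ
open import Data.List.Relation.Unary.All using (All; []; _∷_)
import Data.List.Relation.Unary.All as All
open import Data.List.Relation.Unary.All.Properties using (¬Any⇒All¬) renaming (++⁺ to All-++⁺)
open import Data.List.Relation.Unary.AllPairs using ([]; _∷_)
open import Data.List.Relation.Unary.Any using (here; there)
open import Data.List.Relation.Unary.Linked using (Linked; []; [-]; _∷_)
open import Data.List.Relation.Unary.Unique.Propositional using (Unique)
open import Data.Nat using (ℕ; zero; suc; _≤_; _<_; z≤n; s≤s; _<ᵇ_; _<?_)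
open import Data.Nat.Induction using (<-wellFounded)
open import Data.Nat.Properties using (m≤n⇒m≤1+n; <ᵇ⇒<; <⇒<ᵇ; <⇒≱; ≤-trans; ≤-reflexive)
  renaming (suc-injective to ℕ-suc-injective)
open import Data.Product using (_×_; _,_; proj₁; proj₂; ∃-syntax; ∃₂)
open import Data.Sum using (_⊎_; inj₁; inj₂)
open import Function using (_∘_; id; mk⇔; _⇔_; Equivalence)
open import Induction.WellFounded using (Acc; acc)
open import Level using (0ℓ)
open import Relation.Binary using (Rel; Decidable; DecidableEquality; Symmetric; _⇒_)
open import Relation.Binary.Construct.Closure.ReflexiveTransitive
  using (Star; ε; _◅_; _◅◅_; gmap; reverse; kleisliStar)
open import Relation.Binary.PropositionalEquality
  using (_≡_; _≢_; refl; sym; trans; cong; subst; ≢-sym; setoid)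
open import Relation.Nullary using (¬_; Dec; yes; no; does; contradiction)
open import Relation.Nullary.Decidable
  using (⌊_⌋; dec-true; dec-false; does-⇔; _×-dec_; _⊎-dec_; _→-dec_; ¬?)

count : ∀ {n} → (Fin n → Bool) → ℕ
count {n} f = countTrue (map f (allFin n))

count-suc : ∀ {n} (f : Fin (suc n) → Bool) →
            count f ≡ countTrue (f zero ∷ map (f ∘ suc) (allFin n))
count-suc f =
  cong (λ bs → countTrue (f zero ∷ bs)) (trans (map-tabulate suc f) (sym (map-tabulate id (f ∘ suc))))

count-cong : ∀ {n} {f g : Fin n → Bool} → (∀ y → f y ≡ g y) → count f ≡ count g
count-cong {n} f≗g = cong countTrue (map-cong f≗g (allFin n))

count-mono : ∀ {n} {f g : Fin n → Bool} → (∀ y → f y ≡ true → g y ≡ true) →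
             count f ≤ count g
count-mono {zero} _ = z≤n
count-mono {suc n} {f} {g} f⊆g rewrite count-suc f | count-suc g with f zero in f0 | g zero in g0
... | true  | true  = s≤s (count-mono (f⊆g ∘ suc))
... | true  | false = contradiction (trans (sym g0) (f⊆g zero f0)) λ ()
... | false | true  = m≤n⇒m≤1+n (count-mono (f⊆g ∘ suc))
... | false | false = count-mono (f⊆g ∘ suc)

count-< : ∀ {n} {f g : Fin n → Bool} (a : Fin n) → (∀ y → f y ≡ true → g y ≡ true) →
          f a ≡ false → g a ≡ true → count f < count g
count-< {suc n} {f} {g} zero f⊆g fa ga rewrite count-suc f | count-suc g | fa | ga =
  s≤s (count-mono (f⊆g ∘ suc))
count-< {suc n} {f} {g} (suc a) f⊆g fa ga rewrite count-suc f | count-suc g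
  with f zero in f0 | g zero in g0
... | true  | true  = s≤s (count-< a (f⊆g ∘ suc) fa ga)
... | true  | false = contradiction (trans (sym g0) (f⊆g zero f0)) λ ()
... | false | true  = m≤n⇒m≤1+n (count-< a (f⊆g ∘ suc) fa ga)
... | false | false = count-< a (f⊆g ∘ suc) fa ga

count-none : ∀ {n} (f : Fin n → Bool) → (∀ y → f y ≡ false) → count f ≡ 0
count-none {zero} f _ = refl
count-none {suc n} f none rewrite count-suc f | none zero = count-none (f ∘ suc) (none ∘ suc)

count-≤1 : ∀ {n} (f : Fin n → Bool) → (∀ x y → f x ≡ true → f y ≡ true → x ≡ y) →
           count f ≤ 1
count-≤1 {zero} f _ = z≤n
count-≤1 {suc n} f atMostOne rewrite count-suc f with f zero in f0
... | true rewrite count-none (f ∘ suc) (λ y → ¬-not (0≢1+n ∘ atMostOne zero (suc y) f0)) =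
  s≤s z≤n
... | false = count-≤1 (f ∘ suc) (λ x y fx fy → suc-injective (atMostOne (suc x) (suc y) fx fy))

count-insert : ∀ {n} {f g : Fin n → Bool} (a : Fin n) → (∀ y → y ≢ a → f y ≡ g y) →
               f a ≡ false → g a ≡ true → count g ≡ suc (count f)
count-insert {suc n} {f} {g} zero agree fa ga rewrite count-suc f | count-suc g | fa | ga =
  cong suc (count-cong (λ y → sym (agree (suc y) λ ())))
count-insert {suc n} {f} {g} (suc a) agree fa ga rewrite count-suc f | count-suc g | agree zero (λ ())
  with g zero
... | true  = cong suc (count-insert a (λ y y≢a → agree (suc y) (y≢a ∘ suc-injective)) fa ga)
... | false = count-insert a (λ y y≢a → agree (suc y) (y≢a ∘ suc-injective)) fa ga

-- Both sides are one less than the count of f with b switched on.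
count-exchange : ∀ {n} {f g : Fin n → Bool} {a b : Fin n} →
                 (∀ y → y ≢ a → y ≢ b → f y ≡ g y) →
                 f a ≡ true → f b ≡ false → g a ≡ false → g b ≡ true → count f ≡ count g
count-exchange {n} {f} {g} {a} {b} agree fa fb ga gb =
  ℕ-suc-injective (trans (sym (count-insert b f≈h-off-b fb hb)) (count-insert a g≈h-off-a ga ha))
  where
  h : Fin n → Bool
  h y = f y ∨ does (y ≟ b)
  hb : h b ≡ true
  hb = trans (cong (f b ∨_) (dec-true (b ≟ b) refl)) (∨-zeroʳ (f b))
  f≈h-off-b : ∀ y → y ≢ b → f y ≡ h y
  f≈h-off-b y y≢b = sym (trans (cong (f y ∨_) (dec-false (y ≟ b) y≢b)) (∨-identityʳ (f y)))
  ha : h a ≡ true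
  ha = cong (_∨ does (a ≟ b)) fa
  g≈h-off-a : ∀ y → y ≢ a → g y ≡ h y
  g≈h-off-a y y≢a with y ≟ b
  ... | yes refl = trans gb (sym (∨-zeroʳ (f y)))
  ... | no y≢b = trans (sym (agree y y≢a y≢b)) (sym (∨-identityʳ (f y)))

module _ {A : Set} where

  AvoidingVertex : Rel A 0ℓ → A → Rel A 0ℓ
  AvoidingVertex R r c d = R c d × c ≢ r × d ≢ r

  AvoidingEdge : Rel A 0ℓ → A → A → Rel A 0ℓ
  AvoidingEdge R a b c d = R c d × ¬ (c ≡ a × d ≡ b) × ¬ (c ≡ b × d ≡ a)

  avoidingVertex⇒avoidingEdge : ∀ {R a b c d} → AvoidingVertex R a c d → AvoidingEdge R a b c d
  avoidingVertex⇒avoidingEdge (e , c≢a , d≢a) = e , c≢a ∘ proj₁ , d≢a ∘ proj₂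

  data Walk (R : Rel A 0ℓ) : A → A → List A → Set where
    done : ∀ {a} → Walk R a a [ a ]
    step : ∀ {a c b vs} → R a c → Walk R c b (c ∷ vs) → Walk R a b (a ∷ c ∷ vs)

  Walk-close : ∀ {R E : Rel A 0ℓ} → R ⇒ E → ∀ {a b z vs} →
               Walk R a b (a ∷ vs) → E b z → Linked E (a ∷ vs ++ [ z ])
  Walk-close R⇒E done bz = bz ∷ [-]
  Walk-close R⇒E (step ac w) bz = R⇒E ac ∷ Walk-close R⇒E w bz

  module _ (_≟ᴬ_ : DecidableEquality A) {R : Rel A 0ℓ} where

    open import Data.List.Membership.DecPropositional _≟ᴬ_ using (_∈?_)

    Star⇒path : ∀ {a b} → Star R a b → ∃[ vs ] (Walk R a b (a ∷ vs) × Unique (a ∷ vs))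
    Star⇒path ε = [] , done , [] ∷ []
    Star⇒path {a} (ac ◅ w) with Star⇒path w
    ... | vs , path , unique with a ∈? (_ ∷ vs)
    ...   | no a∉ = _ , step ac path , ¬Any⇒All¬ _ a∉ ∷ unique
    ...   | yes a∈ = cutAt path unique a∈
      where
      cutAt : ∀ {c vs} → Walk R c _ (c ∷ vs) → Unique (c ∷ vs) → a ∈ c ∷ vs →
              ∃[ ws ] (Walk R a _ (a ∷ ws) × Unique (a ∷ ws))
      cutAt p u (here refl) = _ , p , u
      cutAt (step _ p) (_ ∷ u) (there a∈) = cutAt p u a∈

    lastDeparture : ∀ {v u} → u ≢ v → Star R v u →
                    ∃[ w ] (R v w × Star (AvoidingVertex R v) w u)
    lastDeparture {v} {u} u≢v walk = finish (leave walk)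
      where
      Avoiding : Rel A 0ℓ
      Avoiding = Star (AvoidingVertex R v)
      Departure : Set
      Departure = ∃[ w ] (R v w × Avoiding w u)
      start≢v : ∀ {c} → Avoiding c u → c ≢ v
      start≢v ε = u≢v
      start≢v ((_ , c≢v , _) ◅ _) = c≢v
      leave : ∀ {s} → Star R s u → Avoiding s u ⊎ Departure
      leave ε = inj₁ ε
      leave {s} (sc ◅ w) with leave w
      ... | inj₂ departure = inj₂ departure
      ... | inj₁ p with s ≟ᴬ v
      ...   | yes refl = inj₂ (_ , sc , p)
      ...   | no s≢v = inj₁ ((sc , s≢v , start≢v p) ◅ p)
      finish : Avoiding v u ⊎ Departure → Departure
      finish (inj₁ p) = ⊥-elim (start≢v p refl)
      finish (inj₂ departure) = departure

module _ {A : Set} {R : Rel A 0ℓ} where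

  Linked-split : ∀ xs {m ys} → Linked R (xs ++ m ∷ ys) → Linked R (xs ++ [ m ]) × Linked R (m ∷ ys)
  Linked-split [] l = [-] , l
  Linked-split (x ∷ []) (r ∷ l) = r ∷ [-] , l
  Linked-split (x ∷ y ∷ xs) (r ∷ l) with Linked-split (y ∷ xs) l
  ... | left , right = r ∷ left , right

  Linked-join : ∀ xs {m ys} → Linked R (xs ++ [ m ]) → Linked R (m ∷ ys) → Linked R (xs ++ m ∷ ys)
  Linked-join [] _ right = right
  Linked-join (x ∷ []) (r ∷ _) right = r ∷ right
  Linked-join (x ∷ y ∷ xs) (r ∷ left) right = r ∷ Linked-join (y ∷ xs) left right

  Linked-restrict : ∀ {P : A → Set} {S : Rel A 0ℓ} →
                    (∀ {c d} → R c d → P c → P d → S c d) →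
                    ∀ {xs} → Linked R xs → All P xs → Linked S xs
  Linked-restrict f [] _ = []
  Linked-restrict f [-] _ = [-]
  Linked-restrict f (r ∷ l) (pc ∷ pds@(pd ∷ _)) = f r pc pd ∷ Linked-restrict f l pds

module _ {n : ℕ} (H : Graph n) where

  open import Data.List.Membership.DecPropositional (_≟_ {n}) using (_∈?_)

  Edge-sym : ∀ {a b} → Edge H a b → Edge H b a
  Edge-sym {a} {b} e = trans (adj-sym H b a) e

  Edge-irrefl : ∀ {a} → ¬ Edge H a a
  Edge-irrefl {a} e with () ← trans (sym e) (irref H a)

  Edge⇒≢ : ∀ {a b} → Edge H a b → a ≢ b
  Edge⇒≢ e refl = Edge-irrefl e

  Cycle : Fin n → List (Fin n) → Set
  Cycle x xs = 2 ≤ length xs × Unique (x ∷ xs) × Linked (Edge H) (x ∷ xs ++ [ x ])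

  OnCycle : Fin n → Set
  OnCycle r = ∃₂ λ a b → a ≢ b × Edge H r a × Edge H r b × Star (AvoidingVertex (Edge H) r) a b

  Acyclic⇒bridge : Acyclic H → ∀ {a b} → Edge H a b → ¬ Star (AvoidingEdge (Edge H) a b) a b
  Acyclic⇒bridge acyclic {a} ab walk with Star⇒path _≟_ walk
  ... | [] , done , _ = Edge-irrefl ab
  ... | _ ∷ [] , step (_ , ¬ab , _) done , _ = ¬ab (refl , refl)
  ... | _ ∷ _ ∷ _ , path@(step _ (step _ _)) , unique =
    acyclic (a , _ , s≤s (s≤s z≤n) , unique , Walk-close proj₁ path (Edge-sym ab))

  rotate : ∀ {x xs r} → Cycle x xs → r ∈ xs → ∃[ ys ] Cycle r ys
  rotate {x} {r = r} (long , unique , linked) r∈xs with ∈-∃++ r∈xs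
  ... | pre , post , refl = post ++ x ∷ pre , long′ , unique′ , linked′
    where
    open Permutationₛ (setoid (Fin n)) using (Unique-resp-↭)
    swapped : (x ∷ pre) ++ (r ∷ post) ↭ (r ∷ post) ++ (x ∷ pre)
    swapped = ++-comm (x ∷ pre) (r ∷ post)
    long′ : 2 ≤ length (post ++ x ∷ pre)
    long′ = subst (2 ≤_) (ℕ-suc-injective (↭-length swapped)) long
    unique′ : Unique (r ∷ post ++ x ∷ pre)
    unique′ = Unique-resp-↭ (↭⇒↭ₛ swapped) unique
    halves : Linked (Edge H) (x ∷ pre ++ [ r ]) × Linked (Edge H) (r ∷ post ++ [ x ])
    halves = Linked-split (x ∷ pre)
               (subst (λ zs → Linked (Edge H) (x ∷ zs)) (++-assoc pre (r ∷ post) [ x ]) linked)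
    linked′ : Linked (Edge H) (r ∷ (post ++ x ∷ pre) ++ [ r ])
    linked′ = subst (λ zs → Linked (Edge H) (r ∷ zs)) (sym (++-assoc post (x ∷ pre) [ r ]))
                (Linked-join (r ∷ post) (proj₂ halves) (proj₁ halves))

  cycle-arc : ∀ {r} a w ws → Linked (Edge H) (a ∷ w ∷ ws ++ [ r ]) →
              All (r ≢_) (a ∷ w ∷ ws) →
              ∃[ b ] (b ∈ w ∷ ws × Edge H b r × Star (AvoidingVertex (Edge H) r) a b)
  cycle-arc a w [] (aw ∷ wr ∷ [-]) (r≢a ∷ r≢w ∷ []) =
    w , here refl , wr , (aw , ≢-sym r≢a , ≢-sym r≢w) ◅ ε
  cycle-arc a w (w′ ∷ ws) (aw ∷ linked) (r≢a ∷ r≢w ∷ r∉)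
    with cycle-arc w w′ ws linked (r≢w ∷ r∉)
  ... | b , b∈ , br , walk = b , there b∈ , br , (aw , ≢-sym r≢a , ≢-sym r≢w) ◅ walk

  cycle⇒OnCycle : ∀ {r ys} → Cycle r ys → OnCycle r
  cycle⇒OnCycle {ys = _ ∷ []} (s≤s () , _)
  cycle⇒OnCycle {r} {a ∷ w ∷ ws} (_ , (r∉ ∷ a∉ ∷ _) , ra ∷ linked)
    with cycle-arc a w ws linked r∉
  ... | b , b∈ , br , walk = a , b , (λ { refl → All.lookup a∉ b∈ refl }) , ra , Edge-sym br , walk

  acyclic-via-vertex : ∀ (T : Graph n) r → Acyclic T →
    (∀ {c d} → Edge H c d → c ≢ r → d ≢ r → Edge T c d) → ¬ OnCycle r → Acyclic H
  acyclic-via-vertex T r acyclicT away noCycle (x , xs , cycle@(long , unique , linked))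
    with r ∈? (x ∷ xs)
  ... | yes (here refl) = noCycle (cycle⇒OnCycle cycle)
  ... | yes (there r∈xs) = noCycle (cycle⇒OnCycle (proj₂ (rotate cycle r∈xs)))
  ... | no r∉ with ¬Any⇒All¬ _ r∉
  ...   | r≢x ∷ r≢xs = acyclicT (x , xs , long , unique ,
            Linked-restrict (λ cd r≢c r≢d → away cd (≢-sym r≢c) (≢-sym r≢d)) linked
              (r≢x ∷ All-++⁺ r≢xs (r≢x ∷ [])))

Bool-ext : ∀ {a b : Bool} → (a ≡ true → b ≡ true) → (b ≡ true → a ≡ true) → a ≡ b
Bool-ext {true} a⇒b _ = sym (a⇒b refl)
Bool-ext {false} {true} _ b⇒a = b⇒a refl
Bool-ext {false} {false} _ _ = refl

module _ {n : ℕ} {R : Rel (Fin n) 0ℓ} (R? : Decidable R) (R-sym : Symmetric R)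
         (R-irrefl : ∀ {x} → ¬ R x x) where

  graphOf : Graph n
  graphOf = record
    { adj = λ c d → does (R? c d)
    ; sym = λ c d → does-⇔ (mk⇔ R-sym R-sym) (R? c d) (R? d c)
    ; irref = λ c → dec-false (R? c c) R-irrefl
    }

  Edge-graphOf⁺ : ∀ {c d} → R c d → Edge graphOf c d
  Edge-graphOf⁺ = dec-true (R? _ _)

  Edge-graphOf⁻ : ∀ {c d} → Edge graphOf c d → R c d
  Edge-graphOf⁻ {c} {d} with R? c d
  ... | yes r = λ _ → r
  ... | no _ = λ ()

isHigh : ∀ {n} → Graph n → Fin n → Bool
isHigh T x = 2 <ᵇ deg T x

isHigh⇔ : ∀ {n} (T : Graph n) x → isHigh T x ≡ true ⇔ 2 < deg T x
isHigh⇔ T x = mk⇔ (<ᵇ⇒< 2 (deg T x) ∘ Equivalence.from T-≡) (Equivalence.to T-≡ ∘ <⇒<ᵇ)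

highCount : ∀ {n} → Graph n → ℕ
highCount T = count (isHigh T)

module Transplant {n : ℕ} {G T : Graph n} (hist : HIST T G) {u v : Fin n} (u≢v : u ≢ v)
                  (twins : TrueTwins G u v) where

  T⊆G : Subgraph T G
  T⊆G = proj₁ (proj₁ hist)

  T-connected : Connected T
  T-connected = proj₁ (proj₂ (proj₁ hist))

  T-acyclic : Acyclic T
  T-acyclic = proj₂ (proj₂ (proj₁ hist))

  bridge : ∀ {a b} → Edge T a b → ¬ Star (AvoidingEdge (Edge T) a b) a b
  bridge = Acyclic⇒bridge T T-acyclic

  departure : ∃[ w ] (Edge T v w × Star (AvoidingVertex (Edge T) v) w u)
  departure = lastDeparture _≟_ {R = Edge T} u≢v (T-connected v u)

  w₀ : Fin n
  w₀ = proj₁ departure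

  v-w₀ : Edge T v w₀
  v-w₀ = proj₁ (proj₂ departure)

  w₀⇝u : Star (AvoidingVertex (Edge T) v) w₀ u
  w₀⇝u = proj₂ (proj₂ departure)

  Moved : Fin n → Set
  Moved y = Edge T v y × y ≢ w₀

  Moved? : ∀ y → Dec (Moved y)
  Moved? y = (adj T v y ≟ᵇ true) ×-dec ¬? (y ≟ w₀)

  moved≢v : ∀ {y} → Moved y → y ≢ v
  moved≢v (vy , _) = Edge⇒≢ T vy ∘ sym

  v⇝u-avoiding : ∀ {y} → Moved y → Star (AvoidingEdge (Edge T) v y) v u
  v⇝u-avoiding (_ , y≢w₀) =
    (v-w₀ , y≢w₀ ∘ sym ∘ proj₂ , Edge⇒≢ T v-w₀ ∘ sym ∘ proj₂) ◅
    gmap id (avoidingVertex⇒avoidingEdge {R = Edge T}) w₀⇝u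

  moved≢u : ∀ {y} → Moved y → y ≢ u
  moved≢u m@(vy , _) refl = bridge vy (v⇝u-avoiding m)

  moved-nonadjacent : ∀ {y} → Moved y → ¬ Edge T u y
  moved-nonadjacent m@(vy , _) uy =
    bridge vy (v⇝u-avoiding m ◅◅ (uy , u≢v ∘ proj₁ , moved≢u m ∘ sym ∘ proj₁) ◅ ε)

  unmoved-neighbour-of-v : ∀ {z} → Edge T v z → ¬ Moved z → z ≡ w₀
  unmoved-neighbour-of-v {z} vz unmoved with z ≟ w₀
  ... | yes z≡w₀ = z≡w₀
  ... | no z≢w₀ = ⊥-elim (unmoved (vz , z≢w₀))

  twin-edge : ∀ {y} → Moved y → Edge G u y
  twin-edge m@(vy , _) = trans (proj₂ twins _ (moved≢u m) (moved≢v m)) (T⊆G v _ vy)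

  Kept : Rel (Fin n) 0ℓ
  Kept c d = Edge T c d × (c ≡ v → d ≡ w₀) × (d ≡ v → c ≡ w₀)

  Kept-sym : Symmetric Kept
  Kept-sym (cd , c→ , d→) = Edge-sym T cd , d→ , c→

  Edge′ : Rel (Fin n) 0ℓ
  Edge′ c d = Kept c d ⊎ (c ≡ u × Moved d) ⊎ (d ≡ u × Moved c)

  Kept? : Decidable Kept
  Kept? c d = (adj T c d ≟ᵇ true) ×-dec ((c ≟ v) →-dec (d ≟ w₀))
                                  ×-dec ((d ≟ v) →-dec (c ≟ w₀))

  Edge′? : Decidable Edge′
  Edge′? c d = Kept? c d ⊎-dec ((c ≟ u) ×-dec Moved? d) ⊎-dec ((d ≟ u) ×-dec Moved? c)

  Edge′-sym : Symmetric Edge′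
  Edge′-sym (inj₁ k) = inj₁ (Kept-sym k)
  Edge′-sym (inj₂ (inj₁ new)) = inj₂ (inj₂ new)
  Edge′-sym (inj₂ (inj₂ new)) = inj₂ (inj₁ new)

  Edge′-irrefl : ∀ {c} → ¬ Edge′ c c
  Edge′-irrefl (inj₁ (cc , _)) = Edge-irrefl T cc
  Edge′-irrefl (inj₂ (inj₁ (refl , m))) = moved≢u m refl
  Edge′-irrefl (inj₂ (inj₂ (refl , m))) = moved≢u m refl

  T′ : Graph n
  T′ = graphOf Edge′? Edge′-sym Edge′-irrefl

  Edge′⇒T′ : ∀ {c d} → Edge′ c d → Edge T′ c d
  Edge′⇒T′ = Edge-graphOf⁺ Edge′? Edge′-sym Edge′-irrefl

  kept⇒T′ : ∀ {c d} → Kept c d → Edge T′ c d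
  kept⇒T′ = Edge′⇒T′ ∘ inj₁

  T′⇒Edge′ : ∀ {c d} → Edge T′ c d → Edge′ c d
  T′⇒Edge′ = Edge-graphOf⁻ Edge′? Edge′-sym Edge′-irrefl

  avoiding-v⇒kept : ∀ {c d} → AvoidingVertex (Edge T) v c d → Kept c d
  avoiding-v⇒kept (cd , c≢v , d≢v) = cd , ⊥-elim ∘ c≢v , ⊥-elim ∘ d≢v

  T′⊆G : Subgraph T′ G
  T′⊆G c d cd with T′⇒Edge′ cd
  ... | inj₁ (cd , _) = T⊆G c d cd
  ... | inj₂ (inj₁ (refl , m)) = twin-edge m
  ... | inj₂ (inj₂ (refl , m)) = Edge-sym G (twin-edge m)

  v-w₀-kept : Kept v w₀
  v-w₀-kept = v-w₀ , (λ _ → refl) , ⊥-elim ∘ Edge⇒≢ T v-w₀ ∘ sym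

  T-edge-at-v⇒T′-walk : ∀ {d} → Edge T v d → Star (Edge T′) v d
  T-edge-at-v⇒T′-walk {d} vd with d ≟ w₀
  ... | yes refl = kept⇒T′ v-w₀-kept ◅ ε
  ... | no d≢w₀ = kept⇒T′ v-w₀-kept ◅ gmap id (kept⇒T′ ∘ avoiding-v⇒kept) w₀⇝u ◅◅
                    Edge′⇒T′ (inj₂ (inj₁ (refl , vd , d≢w₀))) ◅ ε

  T-edge⇒T′-walk : ∀ {c d} → Edge T c d → Star (Edge T′) c d
  T-edge⇒T′-walk {c} {d} cd with c ≟ v | d ≟ v
  ... | yes refl | _ = T-edge-at-v⇒T′-walk cd
  ... | no _ | yes refl = reverse (Edge-sym T′) (T-edge-at-v⇒T′-walk (Edge-sym T cd))
  ... | no c≢v | no d≢v = kept⇒T′ (avoiding-v⇒kept (cd , c≢v , d≢v)) ◅ ε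

  T′-connected : Connected T′
  T′-connected x y = kleisliStar id T-edge⇒T′-walk (T-connected x y)

  T′-avoiding-u⇒kept : ∀ {c d} → AvoidingVertex (Edge T′) u c d → Kept c d
  T′-avoiding-u⇒kept (cd , c≢u , d≢u) with T′⇒Edge′ cd
  ... | inj₁ kept = kept
  ... | inj₂ (inj₁ (c≡u , _)) = ⊥-elim (c≢u c≡u)
  ... | inj₂ (inj₂ (d≡u , _)) = ⊥-elim (d≢u d≡u)

  T′⇒T-away-from-u : ∀ {c d} → Edge T′ c d → c ≢ u → d ≢ u → Edge T c d
  T′⇒T-away-from-u cd c≢u d≢u = proj₁ (T′-avoiding-u⇒kept (cd , c≢u , d≢u))

  T′-neighbour-of-u : ∀ {x} → Edge T′ u x → Edge T u x ⊎ Moved x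
  T′-neighbour-of-u ux with T′⇒Edge′ ux
  ... | inj₁ (ux , _) = inj₁ ux
  ... | inj₂ (inj₁ (_ , m)) = inj₂ m
  ... | inj₂ (inj₂ (refl , m)) = ⊥-elim (moved≢u m refl)

  kept-avoids-moved : ∀ {x c d} → Moved x → Kept c d → AvoidingEdge (Edge T) v x c d
  kept-avoids-moved (_ , x≢w₀) (cd , c≡v⇒d≡w₀ , d≡v⇒c≡w₀) =
    cd , (λ { (c≡v , refl) → x≢w₀ (c≡v⇒d≡w₀ c≡v) })
       , (λ { (refl , d≡v) → x≢w₀ (d≡v⇒c≡w₀ d≡v) })

  ¬old⇝moved : ∀ {x y} → Edge T u y → Moved x → ¬ Star Kept y x
  ¬old⇝moved uy m@(vx , _) y⇝x = bridge vx
    (v⇝u-avoiding m ◅◅ (uy , u≢v ∘ proj₁ , moved≢u m ∘ sym ∘ proj₁) ◅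
     gmap id (kept-avoids-moved m) y⇝x)

  -- Depending on where its two edges at u come from, a cycle of T′ through u closes a cycle of T
  -- around an edge at u or at v.
  u-on-no-T′-cycle : ¬ OnCycle T′ u
  u-on-no-T′-cycle (a , b , a≢b , ua , ub , a⇝b) with T′-neighbour-of-u ua | T′-neighbour-of-u ub
  ... | inj₁ ua | inj₁ ub = bridge ub
    ((ua , a≢b ∘ proj₂ , Edge⇒≢ T ua ∘ sym ∘ proj₂) ◅ gmap id in-T-avoiding-u a⇝b)
    where
    in-T-avoiding-u : ∀ {c d} → AvoidingVertex (Edge T′) u c d → AvoidingEdge (Edge T) u b c d
    in-T-avoiding-u (cd , c≢u , d≢u) =
      avoidingVertex⇒avoidingEdge {R = Edge T} (T′⇒T-away-from-u cd c≢u d≢u , c≢u , d≢u)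
  ... | inj₁ ua | inj₂ mb = ¬old⇝moved ua mb (gmap id T′-avoiding-u⇒kept a⇝b)
  ... | inj₂ ma | inj₁ ub = ¬old⇝moved ub ma (reverse Kept-sym (gmap id T′-avoiding-u⇒kept a⇝b))
  ... | inj₂ ma@(va , _) | inj₂ mb@(vb , _) = bridge va
    ((vb , a≢b ∘ sym ∘ proj₂ , moved≢v mb ∘ proj₂) ◅
     gmap id (kept-avoids-moved ma) (reverse Kept-sym (gmap id T′-avoiding-u⇒kept a⇝b)))

  T′-acyclic : Acyclic T′
  T′-acyclic = acyclic-via-vertex T′ T u T-acyclic T′⇒T-away-from-u u-on-no-T′-cycle

  T′-neighbour-of-v : ∀ {y} → Edge T′ v y → y ≡ w₀
  T′-neighbour-of-v vy with T′⇒Edge′ vy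
  ... | inj₁ (_ , v≡v⇒y≡w₀ , _) = v≡v⇒y≡w₀ refl
  ... | inj₂ (inj₁ (v≡u , _)) = ⊥-elim (u≢v (sym v≡u))
  ... | inj₂ (inj₂ (_ , vv , _)) = ⊥-elim (Edge-irrefl T vv)

  deg-v : deg T′ v ≤ 1
  deg-v = count-≤1 (adj T′ v) λ x y vx vy →
    trans (T′-neighbour-of-v vx) (sym (T′-neighbour-of-v vy))

  deg-u : deg T u ≤ deg T′ u
  deg-u = count-mono {f = adj T u} {g = adj T′ u} λ y uy →
    kept⇒T′ (uy , ⊥-elim ∘ u≢v ,
             λ { refl → unmoved-neighbour-of-v (Edge-sym T uy) (λ m → moved≢u m refl) })

  adj-unchanged : ∀ {z y} → z ≢ u → z ≢ v → y ≢ u → y ≢ v → adj T′ z y ≡ adj T z y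
  adj-unchanged z≢u z≢v y≢u y≢v =
    Bool-ext (λ zy → T′⇒T-away-from-u zy z≢u y≢u)
             (λ zy → kept⇒T′ (zy , ⊥-elim ∘ z≢v , ⊥-elim ∘ y≢v))

  -- A moved vertex trades its neighbour v for u.
  deg-moved : ∀ {z} → Moved z → deg T′ z ≡ deg T z
  deg-moved {z} m@(vz , z≢w₀) = sym (count-exchange
    (λ y y≢v y≢u → sym (adj-unchanged (moved≢u m) (moved≢v m) y≢u y≢v))
    (Edge-sym T vz) (¬-not (moved-nonadjacent m ∘ Edge-sym T))
    (¬-not (lose-v ∘ T′⇒Edge′)) (Edge′⇒T′ (inj₂ (inj₂ (refl , m)))))
    where
    lose-v : ¬ Edge′ z v
    lose-v (inj₁ (_ , _ , v≡v⇒z≡w₀)) = z≢w₀ (v≡v⇒z≡w₀ refl)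
    lose-v (inj₂ (inj₁ (z≡u , _))) = moved≢u m z≡u
    lose-v (inj₂ (inj₂ (v≡u , _))) = u≢v (sym v≡u)

  deg-unmoved : ∀ {z} → z ≢ u → z ≢ v → ¬ Moved z → deg T′ z ≡ deg T z
  deg-unmoved {z} z≢u z≢v unmoved = count-cong (λ y → Bool-ext (to y) (from y))
    where
    to : ∀ y → Edge T′ z y → Edge T z y
    to y zy with T′⇒Edge′ zy
    ... | inj₁ (zy , _) = zy
    ... | inj₂ (inj₁ (z≡u , _)) = ⊥-elim (z≢u z≡u)
    ... | inj₂ (inj₂ (_ , mz)) = ⊥-elim (unmoved mz)
    from : ∀ y → Edge T z y → Edge T′ z y
    from y zy =
      kept⇒T′ (zy , ⊥-elim ∘ z≢v , λ { refl → unmoved-neighbour-of-v (Edge-sym T zy) unmoved })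

  deg-other : ∀ {z} → z ≢ u → z ≢ v → deg T′ z ≡ deg T z
  deg-other {z} z≢u z≢v with Moved? z
  ... | yes mz = deg-moved mz
  ... | no unmoved = deg-unmoved z≢u z≢v unmoved

  T′-hist : 2 < deg T u → HIST T′ G
  T′-hist u-high = (T′⊆G , T′-connected , T′-acyclic) , no-deg-2
    where
    no-deg-2 : ∀ z → deg T′ z ≢ 2
    no-deg-2 z = by-cases (z ≟ v) (z ≟ u)
      where
      by-cases : Dec (z ≡ v) → Dec (z ≡ u) → deg T′ z ≢ 2
      by-cases (yes refl) _ d≡2 = <⇒≱ (s≤s (s≤s z≤n)) (subst (_≤ 1) d≡2 deg-v)
      by-cases (no _) (yes refl) d≡2 = <⇒≱ (≤-trans u-high deg-u) (≤-reflexive d≡2)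
      by-cases (no z≢v) (no z≢u) d≡2 = proj₂ hist z (trans (sym (deg-other z≢u z≢v)) d≡2)

  highCount-decreases : 2 < deg T u → 2 < deg T v → highCount T′ < highCount T
  highCount-decreases u-high v-high =
    count-< {f = isHigh T′} {g = isHigh T} v still-high v-low (Equivalence.from (isHigh⇔ T v) v-high)
    where
    v-low : isHigh T′ v ≡ false
    v-low = ¬-not λ high → <⇒≱ (Equivalence.to (isHigh⇔ T′ v) high) (≤-trans deg-v (s≤s z≤n))
    still-high : ∀ y → isHigh T′ y ≡ true → isHigh T y ≡ true
    still-high y = by-cases (y ≟ v) (y ≟ u)
      where
      by-cases : Dec (y ≡ v) → Dec (y ≡ u) → isHigh T′ y ≡ true → isHigh T y ≡ true
      by-cases (yes refl) _ high = contradiction (trans (sym high) v-low) λ ()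
      by-cases (no _) (yes refl) _ = Equivalence.from (isHigh⇔ T u) u-high
      by-cases (no y≢v) (no y≢u) high = subst (λ d → (2 <ᵇ d) ≡ true) (deg-other y≢u y≢v) high

module _ {n : ℕ} (G : Graph n) where

  HighTwins : Graph n → Set
  HighTwins T = ∃₂ λ x y → x ≢ y × TrueTwins G x y × 2 < deg T x × 2 < deg T y

  highTwins? : ∀ T → Dec (HighTwins T)
  highTwins? T = any? λ x → any? λ y →
    ¬? (x ≟ y) ×-dec twins? x y ×-dec (2 <? deg T x) ×-dec (2 <? deg T y)
    where
    twins? : ∀ x y → Dec (TrueTwins G x y)
    twins? x y = (adj G x y ≟ᵇ true) ×-dec
      all? (λ w → ¬? (w ≟ x) →-dec ¬? (w ≟ y) →-dec (adj G x w ≟ᵇ adj G y w))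

  highTwinFree : ∀ T → Acc _<_ (highCount T) → HIST T G →
                 ∃[ T′ ] (HIST T′ G × ¬ HighTwins T′)
  highTwinFree T (acc smaller) hist with highTwins? T
  ... | no none = T , hist , none
  ... | yes (x , y , x≢y , twins , x-high , y-high) =
    highTwinFree T′ (smaller (highCount-decreases x-high y-high)) (T′-hist x-high)
    where open Transplant {G = G} {T = T} hist x≢y twins using (T′; T′-hist; highCount-decreases)

highDegInBlock-≤1 : ∀ {n} {G T : Graph n} → ¬ HighTwins G T →
  ∀ {C l p} → TwinPartition G C l p → ∀ i → highDegInBlock T C p i ≤ 1
highDegInBlock-≤1 {n} {G} {T} twin-free {C} {l} {p} (_ , twins) i = count-≤1 counted unique
  where
  counted : Fin n → Bool
  counted x = C x ∧ ⌊ p x ≟ i ⌋ ∧ isHigh T x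
  member : ∀ x → counted x ≡ true → C x ≡ true × p x ≡ i × 2 < deg T x
  member x e with C x | p x ≟ i | isHigh T x in high
  member x e  | true  | yes px≡i | true  = refl , px≡i , Equivalence.to (isHigh⇔ T x) high
  member x () | true  | yes _    | false
  member x () | true  | no _     | _
  member x () | false | _        | _
  unique : ∀ x y → counted x ≡ true → counted y ≡ true → x ≡ y
  unique x y ex ey with x ≟ y | member x ex | member y ey
  ... | yes x≡y | _ | _ = x≡y
  ... | no x≢y | Cx , px≡i , x-high | Cy , py≡i , y-high =
    ⊥-elim (twin-free (x , y , x≢y , twins x y Cx Cy (trans px≡i (sym py≡i)) x≢y , x-high , y-high))

lemma6 : ∀ {n} (G : Graph n) (S : VSet n) → IsCluster G S →
    (∃[ T ] HIST T G) →
    ∃[ T ] (HIST T G ×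
    (∀ (C : VSet n) → IsComponent G S C →
    ∀ (l : ℕ) (p : Fin n → Fin l) → TwinPartition G C l p →
    ∀ (i : Fin l) → highDegInBlock T C p i ≤ 1))
lemma6 G S _ (T , hist) with highTwinFree G T (<-wellFounded (highCount T)) hist
... | T′ , hist′ , twin-free =
  T′ , hist′ , λ C _ l p partition → highDegInBlock-≤1 {G = G} {T = T′} twin-free partition
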